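{- Let $G=(U,V,E)$ be a bipartite graph with $|U|=|V|=N$ and let $l\geq 0$ be an integer. Suppose $G$ contains a perfect matching and that for every non-perfect matching $M\subseteq E$ there exists an augmenting path for $M$ of length at most $2l+1$. Run the simplified auction algorithm on $G$. Then $h_v(i)\leq l+1$ for every $v\in V$ and every iteration index $i$ up to termination.
   Context: For a vertex $w$, $n_w$ denotes its set of neighbours. A vertex is free with respect to a matching $M$ if no edge of $M$ is incident to it. A matching $M$ is perfect if $|M|=N$. A path of length $l$ is a sequence of $l+1$ vertices $v_1,\dots,v_{l+1}$ with $\{v_k,v_{k+1}\}\in E$; it is alternating with respect to $M$ if $(v_k,v_{k+1})\notin M$ for odd $k$ and $\in M$ for even $k$; an augmenting path for $M$ is an alternating path from a free vertex of $U$ to a free vertex of $V$. The simplified auction algorithm maintains a matching $M\subseteq E$ and integer values $h_v$, $v\in V$: initially $M=\emptyset$, $h_v=0$. While $|M|<N$ and $\sum_{v\in V}h_v<N(N-1)$, it performs one iteration: choose (arbitrarily) a free vertex $u\in U$; choose $j\in\arg\min_{v\in n_u}h_v$ (ties arbitrary); if some $u_{old}$ has $(u_{old},j)\in M$, remove that edge; add $(u,j)$ to $M$; set $h_j\leftarrow h_j+1$. $h_v(i)$ denotes the value of $v$ after $i$ iterations. -}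

module Defs where

open import Data.Nat using (ℕ; zero; suc; _+_; _*_; _∸_; _≤_; _<_)
open import Data.Fin using (Fin; zero; suc; inject₁; fromℕ; _≟_)
open import Data.Maybe using (Maybe; just; nothing)
open import Data.Bool using (if_then_else_)
open import Data.Product using (Σ; _×_; ∃)
open import Relation.Nullary using (¬_; does)
open import Relation.Binary.PropositionalEquality using (_≡_)

-- A bipartite graph G = (U, V, E) with U = V = Fin N is given by an edge
-- relation  E : Fin N → Fin N → Set  (E u v means {u,v} ∈ E, u ∈ U, v ∈ V).

-- A (candidate) matching is represented by its "mate" function on U:
-- mate u ≡ just v  means  (u , v) ∈ M ;  mate u ≡ nothing means u is free.
Mate : ℕ → Set
Mate N = Fin N → Maybe (Fin N)

InM : ∀ {N} → Mate N → Fin N → Fin N → Set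
InM m u v = m u ≡ just v

-- M ⊆ E and M is a matching (every vertex of V in at most one edge;
-- every vertex of U in at most one edge is built into the representation).
IsMatching : ∀ {N} → (Fin N → Fin N → Set) → Mate N → Set
IsMatching E m =
  (∀ u v → InM m u v → E u v) ×
  (∀ u u' v → InM m u v → InM m u' v → u ≡ u')

countJust : ∀ {n N} → (Fin n → Maybe (Fin N)) → ℕ
countJust {zero} f = 0
countJust {suc n} f with f zero
... | just _  = suc (countJust (λ i → f (suc i)))
... | nothing = countJust (λ i → f (suc i))

size : ∀ {N} → Mate N → ℕ
size = countJust

sumF : ∀ {n} → (Fin n → ℕ) → ℕ
sumF {zero} h = 0
sumF {suc n} h = h zero + sumF (λ i → h (suc i))

FreeU : ∀ {N} → Mate N → Fin N → Set
FreeU m u = m u ≡ nothing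

FreeV : ∀ {N} → Mate N → Fin N → Set
FreeV m v = ∀ u → ¬ InM m u v

-- An augmenting path of length 2k+1 for M:
--   us 0, vs 0, us 1, vs 1, ..., us k, vs k
-- with (us i , vs i) ∈ E \ M  (odd positions) and
-- (vs i , us (i+1)) ∈ M        (even positions),
-- us 0 free in U and vs k free in V.
record AugPath {N} (E : Fin N → Fin N → Set) (m : Mate N) (k : ℕ) : Set where
  field
    us : Fin (suc k) → Fin N
    vs : Fin (suc k) → Fin N
    nonMatchEdge : ∀ i → E (us i) (vs i) × ¬ InM m (us i) (vs i)
    matchEdge    : ∀ (i : Fin k) → InM m (us (suc i)) (vs (inject₁ i))
    startFree    : FreeU m (us zero)
    endFree      : FreeV m (vs (fromℕ k))

record State (N : ℕ) : Set where
  constructor ⟨_,_⟩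
  field
    mate : Mate N
    val  : Fin N → ℕ
open State public

initState : ∀ {N} → State N
initState = ⟨ (λ _ → nothing) , (λ _ → 0) ⟩

record ValidChoice {N} (E : Fin N → Fin N → Set) (s : State N) (u j : Fin N) : Set where
  field
    notPerfect : size (mate s) < N
    budget     : sumF (val s) < N * (N ∸ 1)
    uFree      : FreeU (mate s) u
    jNeighbour : E u j
    jMin       : ∀ v → E u v → val s j ≤ val s v

-- Effect of the iteration: remove (u_old , j) if present, add (u , j),
-- h_j ← h_j + 1.
newMate : ∀ {N} → Mate N → Fin N → Fin N → Mate N
newMate m u j w with does (w ≟ u)
... | Data.Bool.true = just j
... | Data.Bool.false with m w
...   | nothing = nothing
...   | just v = if does (v ≟ j) then nothing else just v

newVal : ∀ {N} → (Fin N → ℕ) → Fin N → Fin N → ℕ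
newVal h j v = if does (v ≟ j) then suc (h v) else h v

iterate : ∀ {N} → State N → Fin N → Fin N → State N
iterate s u j = ⟨ newMate (mate s) u j , newVal (val s) j ⟩

-- Run E i s : s is a possible state after i iterations of the
-- simplified auction algorithm (over all arbitrary choices).
data Run {N} (E : Fin N → Fin N → Set) : ℕ → State N → Set where
  start : Run E 0 initState
  next  : ∀ {i s} u j → Run E i s → ValidChoice E s u j → Run E (suc i) (iterate s u j)

HasPerfectMatching : ∀ {N} → (Fin N → Fin N → Set) → Set
HasPerfectMatching {N} E = Σ (Mate N) λ m → IsMatching E m × size m ≡ N

ShortAugPaths : ∀ {N} → (Fin N → Fin N → Set) → ℕ → Set
ShortAugPaths {N} E l =
  ∀ (m : Mate N) → IsMatching E m → ¬ (size m ≡ N) →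
  Σ ℕ λ k → (2 * k + 1 ≤ 2 * l + 1) × AugPath E m k

module Submission where

open import Defs
open import Data.Nat using (ℕ; suc; _+_; _≤_)
open import Data.Fin using (Fin)

open import Data.Nat as ℕ using (zero; _<_; _∸_; _*_; z≤n; s≤s; _≤?_)
open import Data.Nat.Properties
  using (≤-refl; ≤-trans; ≤-<-trans; n≮n; suc-injective; +-suc; +-comm; +-identityʳ;
         +-∸-assoc; ≤-reflexive; n≤1+n; +-monoʳ-≤; m≤n⇒m≤1+n; m≤n⇒m<n∨m≡n; ≤∧≢⇒<; <⇒≤; <-trans; n<1+n; *-cancelˡ-≤; +-cancelʳ-≤)
open import Data.Nat.Induction using (<-wellFounded)
open import Data.Fin using (zero; suc; toℕ; fromℕ; inject₁; _≟_)
open import Data.Fin.Properties as FinP using (any?; pigeonhole; toℕ≤pred[n])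
open import Data.Maybe using (Maybe; just; nothing)
open import Data.Maybe.Properties using (just-injective; ≡-dec)
open import Data.Product using (_×_; _,_; proj₁; proj₂; ∃)
open import Data.Sum using (_⊎_; inj₁; inj₂)
open import Data.Empty using (⊥-elim)
open import Function using (_∘_)
open import Induction.WellFounded using (Acc; acc)
open import Relation.Nullary using (¬_; Dec; yes; no)
open import Relation.Nullary.Negation using (¬¬-map; contradiction)
open import Relation.Nullary.Decidable using (decidable-stable; ¬?; _×-dec_)
open import Relation.Binary.PropositionalEquality using (_≡_; _≢_; refl; sym; trans; cong; subst)

-- The algorithm keeps an ε-complementary-slackness invariant: if (x, y) ∈ M and
-- {x, v} ∈ E then h_y ≤ h_v + 1, and every unmatched vertex of V has value 0.
-- Along an augmenting path u₀ v₀ … u_k v_k this gives h_{v₀} ≤ k + h_{v_k} = k ≤ l.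
-- The bidder u of an iteration need not start such a path, so we let the algorithm
-- run on the other free vertices until u is the only one left; values only grow,
-- so a low neighbour of u found then was already low. These extra iterations
-- terminate because, comparing with a perfect matching, the bid value stays below N.

countJust≤n : ∀ {n N} (f : Fin n → Maybe (Fin N)) → countJust f ≤ n
countJust≤n {zero} f = z≤n
countJust≤n {suc n} f with f zero
... | just _  = s≤s (countJust≤n (λ i → f (suc i)))
... | nothing = m≤n⇒m≤1+n (countJust≤n (λ i → f (suc i)))

countJust≡n⇒just : ∀ {n N} (f : Fin n → Maybe (Fin N)) → countJust f ≡ n →
  ∀ i → ∃ λ y → f i ≡ just y
countJust≡n⇒just {suc n} f e i with f zero in eq
countJust≡n⇒just {suc n} f e zero    | just y  = y , eq
countJust≡n⇒just {suc n} f e (suc i) | just y  =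
  countJust≡n⇒just (λ i → f (suc i)) (suc-injective e) i
countJust≡n⇒just {suc n} f e i       | nothing =
  contradiction (subst (_≤ n) e (countJust≤n (λ i → f (suc i)))) (n≮n n)

sumF-cong : ∀ {n} (g g' : Fin n → ℕ) → (∀ v → g v ≡ g' v) → sumF g ≡ sumF g'
sumF-cong {zero}  g g' e = refl
sumF-cong {suc n} g g' e
  rewrite e zero | sumF-cong (λ i → g (suc i)) (λ i → g' (suc i)) (λ i → e (suc i)) = refl

sumF-suc : ∀ {n} (g g' : Fin n → ℕ) (j : Fin n) → g j ≡ suc (g' j) →
  (∀ v → v ≢ j → g v ≡ g' v) → sumF g ≡ suc (sumF g')
sumF-suc {suc n} g g' zero ej eo
  rewrite ej | sumF-cong (λ i → g (suc i)) (λ i → g' (suc i)) (λ i → eo (suc i) (λ ())) = refl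
sumF-suc {suc n} g g' (suc j) ej eo
  rewrite eo zero (λ ())
        | sumF-suc (λ i → g (suc i)) (λ i → g' (suc i)) j ej
                   (λ v v≢j → eo (suc v) (λ e → v≢j (FinP.suc-injective e)))
  = +-suc (g' zero) (sumF (λ i → g' (suc i)))

path-slack : ∀ k (f : Fin (suc k) → ℕ) → (∀ (i : Fin k) → f (inject₁ i) ≤ suc (f (suc i))) →
  f zero ≤ k + f (fromℕ k)
path-slack zero    f step = ≤-refl
path-slack (suc k) f step =
  ≤-trans (step zero) (s≤s (path-slack k (λ i → f (suc i)) (λ i → step (suc i))))

¬¬-argmin : ∀ {a p} {A : Set a} (P : A → Set p) (g : A → ℕ) → ∃ P →
  ¬ ¬ (∃ λ j → P j × (∀ v → P v → g j ≤ g v))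
¬¬-argmin P g (v₀ , p₀) ¬min = n≮n (g v₀) (bounded-below (suc (g v₀)) v₀ p₀)
  where
  bounded-below : ∀ c v → P v → c ≤ g v
  bounded-below zero    v pv = z≤n
  bounded-below (suc c) v pv with g v ℕ.≟ c
  ... | yes gv≡c = ⊥-elim (¬min (v , pv , λ w pw → subst (_≤ g w) (sym gv≡c) (bounded-below c w pw)))
  ... | no  gv≢c = ≤∧≢⇒< (bounded-below c v pv) (λ e → gv≢c (sym e))

module _ {N : ℕ} (m : Mate N) (u j : Fin N) where

  newMate-bidder : newMate m u j u ≡ just j
  newMate-bidder with u ≟ u
  ... | yes _   = refl
  ... | no  u≢u = ⊥-elim (u≢u refl)

  newMate-just : ∀ w y → newMate m u j w ≡ just y → (w ≡ u × y ≡ j) ⊎ (m w ≡ just y × y ≢ j)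
  newMate-just w y e with w ≟ u
  ... | yes w≡u = inj₁ (w≡u , sym (just-injective e))
  ... | no  _ with m w
  ...   | just v with v ≟ j
  ...     | no v≢j = inj₂ (cong just (just-injective e) , λ y≡j → v≢j (trans (just-injective e) y≡j))

  newMate-keeps : ∀ w y → w ≢ u → m w ≡ just y → y ≢ j → newMate m u j w ≡ just y
  newMate-keeps w y w≢u e y≢j with w ≟ u
  ... | yes w≡u = ⊥-elim (w≢u w≡u)
  ... | no  _ rewrite e with y ≟ j
  ...   | yes y≡j = ⊥-elim (y≢j y≡j)
  ...   | no  _   = refl

  newMate-free : ∀ w → w ≢ u → m w ≡ nothing → newMate m u j w ≡ nothing
  newMate-free w w≢u e with w ≟ u
  ... | yes w≡u = ⊥-elim (w≢u w≡u)
  ... | no  _ rewrite e = refl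

module _ {N : ℕ} (h : Fin N → ℕ) (j : Fin N) where

  newVal-bid : newVal h j j ≡ suc (h j)
  newVal-bid with j ≟ j
  ... | yes _   = refl
  ... | no  j≢j = ⊥-elim (j≢j refl)

  newVal-other : ∀ v → v ≢ j → newVal h j v ≡ h v
  newVal-other v v≢j with v ≟ j
  ... | yes v≡j = ⊥-elim (v≢j v≡j)
  ... | no  _   = refl

  ≤-newVal : ∀ v → h v ≤ newVal h j v
  ≤-newVal v with v ≟ j
  ... | yes _ = n≤1+n (h v)
  ... | no  _ = ≤-refl

free⇒¬perfect : ∀ {N} (m : Mate N) {u} → FreeU m u → ¬ (size m ≡ N)
free⇒¬perfect m {u} u-free perfect with countJust≡n⇒just m perfect u
... | _ , e = contradiction (trans (sym u-free) e) λ ()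

potential : ∀ {N} → State N → ℕ
potential {N} s = sumF (λ v → N ∸ val s v)

potential-iterate : ∀ {N} (s : State N) u j → val s j < N →
  potential s ≡ suc (potential (iterate s u j))
potential-iterate {N} s u j hj<N =
  sumF-suc (λ v → N ∸ val s v) (λ v → N ∸ newVal (val s) j v) j
    (trans (+-∸-assoc 1 hj<N) (cong (λ x → suc (N ∸ x)) (sym (newVal-bid (val s) j))))
    (λ v v≢j → cong (N ∸_) (sym (newVal-other (val s) j v v≢j)))

module _ {N : ℕ} (E : Fin N → Fin N → Set) where

  record Invariant (s : State N) : Set where
    field
      isMatching : IsMatching E (mate s)
      slack      : ∀ x y v → InM (mate s) x y → E x v → val s y ≤ suc (val s v)
      freeV-zero : ∀ y → FreeV (mate s) y → val s y ≡ 0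
  open Invariant

  invariant-init : Invariant initState
  invariant-init = record
    { isMatching = (λ _ _ ()) , (λ _ _ _ ())
    ; slack      = λ _ _ _ ()
    ; freeV-zero = λ _ _ → refl
    }

  invariant-iterate : ∀ s u j → Invariant s → FreeU (mate s) u → E u j →
    (∀ v → E u v → val s j ≤ val s v) → Invariant (iterate s u j)
  invariant-iterate s u j I u-free Euj j-min = record
    { isMatching = inE , injective ; slack = slack′ ; freeV-zero = freeV-zero′ }
    where
    m : Mate N
    m = mate s
    h : Fin N → ℕ
    h = val s
    inE : ∀ x y → newMate m u j x ≡ just y → E x y
    inE x y e with newMate-just m u j x y e
    ... | inj₁ (refl , refl) = Euj
    ... | inj₂ (e′ , _)      = proj₁ (isMatching I) x y e′
    injective : ∀ x x′ y → newMate m u j x ≡ just y → newMate m u j x′ ≡ just y → x ≡ x′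
    injective x x′ y e e′ with newMate-just m u j x y e | newMate-just m u j x′ y e′
    ... | inj₁ (x≡u , _)   | inj₁ (x′≡u , _)   = trans x≡u (sym x′≡u)
    ... | inj₁ (_ , y≡j)   | inj₂ (_ , y≢j)    = ⊥-elim (y≢j y≡j)
    ... | inj₂ (_ , y≢j)   | inj₁ (_ , y≡j)    = ⊥-elim (y≢j y≡j)
    ... | inj₂ (a , _)     | inj₂ (a′ , _)     = proj₂ (isMatching I) x x′ y a a′
    slack′ : ∀ x y v → newMate m u j x ≡ just y → E x v → newVal h j y ≤ suc (newVal h j v)
    slack′ x y v e Exv with newMate-just m u j x y e
    ... | inj₁ (refl , refl) rewrite newVal-bid h j =
      s≤s (≤-trans (j-min v Exv) (≤-newVal h j v))
    ... | inj₂ (a , y≢j) rewrite newVal-other h j y y≢j =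
      ≤-trans (slack I x y v a Exv) (s≤s (≤-newVal h j v))
    freeV-zero′ : ∀ y → FreeV (newMate m u j) y → newVal h j y ≡ 0
    freeV-zero′ y y-free with y ≟ j
    ... | yes refl = ⊥-elim (y-free u (newMate-bidder m u j))
    ... | no  y≢j  = freeV-zero I y λ x a →
      y-free x (newMate-keeps m u j x y (λ { refl → contradiction (trans (sym a) u-free) λ () }) a y≢j)

  invariant-run : ∀ {i s} → Run E i s → Invariant s
  invariant-run start          = invariant-init
  invariant-run (next u j r c) = invariant-iterate _ u j (invariant-run r)
    (ValidChoice.uFree c) (ValidChoice.jNeighbour c) (ValidChoice.jMin c)

  augPath-start≤length : ∀ {s k} → Invariant s → (P : AugPath E (mate s) k) →
    val s (AugPath.vs P zero) ≤ k
  augPath-start≤length {s} {k} I P =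
    ≤-trans (path-slack k (λ i → val s (vs i)) step)
            (≤-reflexive (trans (cong (k +_) (freeV-zero I _ endFree)) (+-identityʳ k)))
    where
    open AugPath P
    step : ∀ i → val s (vs (inject₁ i)) ≤ suc (val s (vs (suc i)))
    step i = slack I (us (suc i)) (vs (inject₁ i)) (vs (suc i)) (matchEdge i) (proj₁ (nonMatchEdge (suc i)))

  -- The walk u = w₀, w₁, … with ms w_i = M w_{i+1} alternates between the perfect
  -- matching ms and M; it cannot revisit a vertex, so within N steps it reaches a
  -- vertex of V that is free in M, and slackness bounds the value of ms u by its length.
  module PerfectMatchingWalk
    (ms : Mate N) (ms-matching : IsMatching E ms) (ms-total : ∀ x → ∃ λ y → ms x ≡ just y)
    (s : State N) (I : Invariant s) (u : Fin N) (u-free : FreeU (mate s) u) where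

    m : Mate N
    m = mate s
    h : Fin N → ℕ
    h = val s

    partnerₘₛ : Fin N → Fin N
    partnerₘₛ x = proj₁ (ms-total x)

    matched? : ∀ y → Dec (∃ λ x → InM m x y)
    matched? y = any? (λ x → ≡-dec _≟_ (m x) (just y))

    partnerₘ : Fin N → Fin N
    partnerₘ y with matched? y
    ... | yes (x , _) = x
    ... | no  _       = u

    partnerₘ-matched : ∀ y → (∃ λ x → InM m x y) → InM m (partnerₘ y) y
    partnerₘ-matched y p with matched? y
    ... | yes (_ , e) = e
    ... | no  ¬p      = ⊥-elim (¬p p)

    walk : ℕ → Fin N
    walk zero    = u
    walk (suc i) = partnerₘ (partnerₘₛ (walk i))

    Alternating : ℕ → Set
    Alternating t = ∀ i → i < t → InM m (walk (suc i)) (partnerₘₛ (walk i))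

    walk-injective : ∀ {t} → Alternating t → ∀ i j → i < j → j ≤ t → walk i ≢ walk j
    walk-injective alt zero (suc j) _ j<t u≡w =
      contradiction (trans (sym u-free) (trans (cong m u≡w) (alt j j<t))) λ ()
    walk-injective alt (suc i) (suc j) (s≤s i<j) j<t w≡w =
      walk-injective alt i j i<j (<⇒≤ j<t)
        (proj₂ ms-matching _ _ _ (proj₂ (ms-total (walk i)))
          (subst (λ y → ms (walk j) ≡ just y) (sym same-partner) (proj₂ (ms-total (walk j)))))
      where
      same-partner : partnerₘₛ (walk i) ≡ partnerₘₛ (walk j)
      same-partner = just-injective
        (trans (sym (alt i (<-trans i<j j<t))) (trans (cong m w≡w) (alt j j<t)))

    ¬alternating-N : ¬ Alternating N
    ¬alternating-N alt with pigeonhole (n<1+n N) (λ (k : Fin (suc N)) → walk (toℕ k))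
    ... | i , j , i<j , w≡w = walk-injective alt (toℕ i) (toℕ j) i<j (toℕ≤pred[n] j) w≡w

    alternating-slack : ∀ t → Alternating t → h (partnerₘₛ u) ≤ t + h (partnerₘₛ (walk t))
    alternating-slack zero    alt = ≤-refl
    alternating-slack (suc t) alt =
      ≤-trans (alternating-slack t (λ i i<t → alt i (m≤n⇒m≤1+n i<t)))
        (≤-trans (+-monoʳ-≤ t one-step) (≤-reflexive (+-suc t _)))
      where
      one-step : h (partnerₘₛ (walk t)) ≤ suc (h (partnerₘₛ (walk (suc t))))
      one-step = slack I (walk (suc t)) _ _ (alt t ≤-refl)
                   (proj₁ ms-matching _ _ (proj₂ (ms-total (walk (suc t)))))

    alternating-or-bounded : ∀ t → Alternating t ⊎ h (partnerₘₛ u) < t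
    alternating-or-bounded zero = inj₁ (λ _ ())
    alternating-or-bounded (suc t) with alternating-or-bounded t
    ... | inj₂ bounded = inj₂ (m≤n⇒m≤1+n bounded)
    ... | inj₁ alt with matched? (partnerₘₛ (walk t))
    ...   | yes p  = inj₁ extended
      where
      extended : Alternating (suc t)
      extended i (s≤s i≤t) with m≤n⇒m<n∨m≡n i≤t
      ... | inj₁ i<t  = alt i i<t
      ... | inj₂ refl = partnerₘ-matched _ p
    ...   | no  ¬p = inj₂ (s≤s (subst (h (partnerₘₛ u) ≤_) end-zero (alternating-slack t alt)))
      where
      end-zero : t + h (partnerₘₛ (walk t)) ≡ t
      end-zero = trans (cong (t +_) (freeV-zero I _ (λ x a → ¬p (x , a)))) (+-identityʳ t)

    partnerₘₛ-val<N : h (partnerₘₛ u) < N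
    partnerₘₛ-val<N with alternating-or-bounded N
    ... | inj₁ alt     = contradiction alt ¬alternating-N
    ... | inj₂ bounded = bounded

  LowNeighbour : ℕ → State N → Fin N → Set
  LowNeighbour l s u = ∃ λ y → E u y × val s y ≤ l

  lowNeighbour-iterate : ∀ {l} s u′ j u → LowNeighbour l (iterate s u′ j) u → LowNeighbour l s u
  lowNeighbour-iterate s u′ j u (y , Euy , y≤l) = y , Euy , ≤-trans (≤-newVal (val s) j y) y≤l

  sole-free-lowNeighbour : ∀ {l s u} → ShortAugPaths E l → Invariant s → FreeU (mate s) u →
    (∀ w → FreeU (mate s) w → w ≡ u) → LowNeighbour l s u
  sole-free-lowNeighbour {l} {s} {u} short I u-free sole
    with short (mate s) (isMatching I) (free⇒¬perfect (mate s) u-free)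
  ... | k , 2k+1≤2l+1 , P =
    vs zero , subst (λ x → E x (vs zero)) (sole (us zero) startFree) (proj₁ (nonMatchEdge zero)) ,
    ≤-trans (augPath-start≤length I P) (*-cancelˡ-≤ 2 (+-cancelʳ-≤ 1 (2 * k) (2 * l) 2k+1≤2l+1))
    where open AugPath P

  module _ {l : ℕ} (short : ShortAugPaths E l)
    (ms : Mate N) (ms-matching : IsMatching E ms) (ms-total : ∀ x → ∃ λ y → ms x ≡ just y) where

    free-lowNeighbour : ∀ s → Acc _<_ (potential s) → Invariant s →
      ∀ u → FreeU (mate s) u → ¬ ¬ LowNeighbour l s u
    free-lowNeighbour s (acc rec) I u u-free
      with any? (λ w → ¬? (w ≟ u) ×-dec ≡-dec _≟_ (mate s w) nothing)
    ... | no ¬other = λ ¬low → ¬low (sole-free-lowNeighbour short I u-free sole)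
      where
      sole : ∀ w → FreeU (mate s) w → w ≡ u
      sole w w-free with w ≟ u
      ... | yes w≡u = w≡u
      ... | no  w≢u = ⊥-elim (¬other (w , w≢u , w-free))
    ... | yes (u′ , u′≢u , u′-free) = λ ¬low →
      ¬¬-argmin (E u′) (val s) (partnerₘₛ u′ , E-partnerₘₛ) λ (j , Eu′j , j-min) →
        free-lowNeighbour (iterate s u′ j) (rec (potential-decreases j j-min))
          (invariant-iterate s u′ j I u′-free Eu′j j-min)
          u (newMate-free (mate s) u′ j u (λ u≡u′ → u′≢u (sym u≡u′)) u-free)
          (¬low ∘ lowNeighbour-iterate s u′ j u)
      where
      open PerfectMatchingWalk ms ms-matching ms-total s I u′ u′-free using (partnerₘₛ; partnerₘₛ-val<N)
      E-partnerₘₛ : E u′ (partnerₘₛ u′)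
      E-partnerₘₛ = proj₁ ms-matching _ _ (proj₂ (ms-total u′))
      potential-decreases : ∀ j → (∀ v → E u′ v → val s j ≤ val s v) →
        potential (iterate s u′ j) < potential s
      potential-decreases j j-min = ≤-reflexive (sym (potential-iterate s u′ j
        (≤-<-trans (j-min (partnerₘₛ u′) E-partnerₘₛ) partnerₘₛ-val<N)))

    bid≤l : ∀ {i s u j} → Run E i s → ValidChoice E s u j → val s j ≤ l
    bid≤l {s = s} {u} {j} r c = decidable-stable (val s j ≤? l)
      (¬¬-map (λ (y , Euy , y≤l) → ≤-trans (ValidChoice.jMin c y Euy) y≤l)
        (free-lowNeighbour s (<-wellFounded (potential s)) (invariant-run r) u (ValidChoice.uFree c)))

mainTheorem7 : (N : ℕ) (E : Fin N → Fin N → Set) (l : ℕ) →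
    HasPerfectMatching E → ShortAugPaths E l →
    ∀ (i : ℕ) (s : State N) → Run E i s → ∀ (v : Fin N) → val s v ≤ l + 1
mainTheorem7 N E l (ms , ms-matching , ms-size) short = bound
  where
  bound : ∀ (i : ℕ) (s : State N) → Run E i s → ∀ (v : Fin N) → val s v ≤ l + 1
  bound _ _ start v = z≤n
  bound _ _ (next {s = s} u j r c) v with v ≟ j
  ... | yes refl = subst (suc (val s v) ≤_) (+-comm 1 l)
                     (s≤s (bid≤l E short ms ms-matching (countJust≡n⇒just ms ms-size) r c))
  ... | no  _    = bound _ s r v
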